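{- Let $\mathfrak{A}$ be a Heyting algebra and $a\in|\mathfrak{A}|$. If $a$ is enrichable in $\mathfrak{A}$, then $a$ is enriched by exactly one element of $\mathfrak{A}$.
   Context: In a Heyting algebra $\mathfrak{A}$, an element $b$ enriches $a$ (and $a$ is enrichable) if: (a) $a\le b$; (b) $b\rightarrow a=a$; (c) $b\le x\vee(x\rightarrow a)$ for every $x\in|\mathfrak{A}|$. -}

module Defs where

open import Level using (_⊔_)
open import Data.Product using (Σ; _×_)
open import Relation.Binary.Lattice.Bundles using (HeytingAlgebra)

module _ {c ℓ₁ ℓ₂} (H : HeytingAlgebra c ℓ₁ ℓ₂) where
  open HeytingAlgebra H

  Enriches : Carrier → Carrier → Set (c ⊔ ℓ₁ ⊔ ℓ₂)
  Enriches b a = (a ≤ b) × ((b ⇨ a) ≈ a) × (∀ x → b ≤ (x ∨ (x ⇨ a)))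

  Enrichable : Carrier → Set (c ⊔ ℓ₁ ⊔ ℓ₂)
  Enrichable a = Σ Carrier (λ b → Enriches b a)

-- Enriching elements of a are mutually comparable: if p and q both enrich a, then
-- instantiating condition (c) for p at x = q gives p ≤ q ∨ (q ⇨ a) = q ∨ a = q.
module Submission where

open import Defs
open import Data.Product using (Σ; _×_; _,_)
open import Relation.Binary.Lattice.Bundles using (HeytingAlgebra)

module _ {c ℓ₁ ℓ₂} (H : HeytingAlgebra c ℓ₁ ℓ₂) where
  open HeytingAlgebra H

  enriches-≤ : ∀ {a p q} → Enriches H p a → Enriches H q a → p ≤ q
  enriches-≤ {a} {p} {q} (_ , _ , p≤x∨x⇨a) (a≤q , q⇨a≈a , _) =
    trans (p≤x∨x⇨a q) (∨-least refl q⇨a≤q)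
    where
    q⇨a≤q : (q ⇨ a) ≤ q
    q⇨a≤q = trans (reflexive q⇨a≈a) a≤q

  enriches-unique : ∀ {a p q} → Enriches H p a → Enriches H q a → p ≈ q
  enriches-unique ep eq = antisym (enriches-≤ ep eq) (enriches-≤ eq ep)

propositionP : ∀ {c ℓ₁ ℓ₂} (H : HeytingAlgebra c ℓ₁ ℓ₂) (a : HeytingAlgebra.Carrier H) →
               Enrichable H a →
               Σ (HeytingAlgebra.Carrier H) (λ b → Enriches H b a ×
                 (∀ b′ → Enriches H b′ a → HeytingAlgebra._≈_ H b′ b))
propositionP H a (b , eb) = b , eb , λ b′ eb′ → enriches-unique H eb′ eb
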